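{- For all objects $X,Y,Z$ of $\mathsf{C}$ and all $\alpha \in Q(X)$, $\beta \in Q(Y)$, $\gamma \in Q((X \otimes Y)\multimap Z)$, the following relation holds: $$\langle\,\mu_{X,Y}(\alpha,\beta),\,\gamma\rangle_{X\otimes Y,Z} = \langle \,\alpha,\,\langle \beta,Q(\psi)(\gamma)\,\rangle_{Y, X \multimap Z}\,\rangle_{X,Z}\,.$$
   Context: Let $\mathsf{C}$ be a $\ast$-autonomous (in particular symmetric monoidal closed) category with tensor $\otimes$, internal hom $\multimap$, and evaluation (counit) maps $\mathtt{ev}_{X,Y} : X \otimes (X \multimap Y) \to Y$, and let $Q : \mathsf{C} \to \mathsf{SLatt}$ be a monoidal functor (into the category of complete lattices and sup-preserving maps) with structure maps $\mu_{X,Y} : Q(X) \times Q(Y) \to Q(X \otimes Y)$, natural in $X,Y$ and sup-preserving in each variable. For objects $X,Y$ define $\langle -,- \rangle_{X,Y} := Q(\mathtt{ev}_{X,Y}) \circ \mu_{X,X\multimap Y} : Q(X) \times Q(X \multimap Y) \to Q(Y)$. Let $\psi : (X \otimes Y) \multimap Z \to Y \multimap (X \multimap Z)$ be the canonical natural isomorphism, i.e. the unique arrow such that $\mathtt{ev}_{X,Z} \circ (X \otimes \mathtt{ev}_{Y,X\multimap Z}) \circ (X \otimes Y \otimes \psi) = \mathtt{ev}_{X\otimes Y,Z}$ (up to the associativity isomorphisms). -}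

module Defs where

open import Level using (Level; _⊔_) renaming (suc to lsuc)
open import Relation.Binary using (Rel; IsEquivalence; IsPartialOrder)

record Category (o ℓ e : Level) : Set (lsuc (o ⊔ ℓ ⊔ e)) where
  infix  4 _≈_ _⇒_
  infixr 9 _∘_
  field
    Obj : Set o
    _⇒_ : Obj → Obj → Set ℓ
    _≈_ : ∀ {A B} → Rel (A ⇒ B) e
    id  : ∀ {A} → A ⇒ A
    _∘_ : ∀ {A B C} → B ⇒ C → A ⇒ B → A ⇒ C
    equiv     : ∀ {A B} → IsEquivalence (_≈_ {A} {B})
    assoc     : ∀ {A B C D} {f : A ⇒ B} {g : B ⇒ C} {h : C ⇒ D} →
                (h ∘ g) ∘ f ≈ h ∘ (g ∘ f)
    identityˡ : ∀ {A B} {f : A ⇒ B} → id ∘ f ≈ f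
    identityʳ : ∀ {A B} {f : A ⇒ B} → f ∘ id ≈ f
    ∘-resp-≈  : ∀ {A B C} {f h : B ⇒ C} {g i : A ⇒ B} →
                f ≈ h → g ≈ i → f ∘ g ≈ h ∘ i

record Monoidal {o ℓ e} (C : Category o ℓ e) : Set (o ⊔ ℓ ⊔ e) where
  open Category C
  infixr 10 _⊗₀_ _⊗₁_
  field
    _⊗₀_ : Obj → Obj → Obj
    _⊗₁_ : ∀ {A B C D} → A ⇒ B → C ⇒ D → (A ⊗₀ C) ⇒ (B ⊗₀ D)
    unit : Obj
    ⊗-identity     : ∀ {A B} → id {A} ⊗₁ id {B} ≈ id
    ⊗-homomorphism : ∀ {A B C D E F} {f : A ⇒ B} {g : B ⇒ C} {h : D ⇒ E} {i : E ⇒ F} →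
                     (g ∘ f) ⊗₁ (i ∘ h) ≈ (g ⊗₁ i) ∘ (f ⊗₁ h)
    ⊗-resp-≈       : ∀ {A B C D} {f g : A ⇒ B} {h i : C ⇒ D} →
                     f ≈ g → h ≈ i → f ⊗₁ h ≈ g ⊗₁ i
    α⇒ : ∀ {X Y Z} → (X ⊗₀ Y) ⊗₀ Z ⇒ X ⊗₀ (Y ⊗₀ Z)
    α⇐ : ∀ {X Y Z} → X ⊗₀ (Y ⊗₀ Z) ⇒ (X ⊗₀ Y) ⊗₀ Z
    λ⇒ : ∀ {X} → unit ⊗₀ X ⇒ X
    λ⇐ : ∀ {X} → X ⇒ unit ⊗₀ X
    ρ⇒ : ∀ {X} → X ⊗₀ unit ⇒ X
    ρ⇐ : ∀ {X} → X ⇒ X ⊗₀ unit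
    α-isoˡ : ∀ {X Y Z} → α⇐ {X} {Y} {Z} ∘ α⇒ ≈ id
    α-isoʳ : ∀ {X Y Z} → α⇒ {X} {Y} {Z} ∘ α⇐ ≈ id
    λ-isoˡ : ∀ {X} → λ⇐ {X} ∘ λ⇒ ≈ id
    λ-isoʳ : ∀ {X} → λ⇒ {X} ∘ λ⇐ ≈ id
    ρ-isoˡ : ∀ {X} → ρ⇐ {X} ∘ ρ⇒ ≈ id
    ρ-isoʳ : ∀ {X} → ρ⇒ {X} ∘ ρ⇐ ≈ id
    α-natural : ∀ {X X′ Y Y′ Z Z′} {f : X ⇒ X′} {g : Y ⇒ Y′} {h : Z ⇒ Z′} →
                α⇒ ∘ ((f ⊗₁ g) ⊗₁ h) ≈ (f ⊗₁ (g ⊗₁ h)) ∘ α⇒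
    λ-natural : ∀ {X Y} {f : X ⇒ Y} → λ⇒ ∘ (id ⊗₁ f) ≈ f ∘ λ⇒
    ρ-natural : ∀ {X Y} {f : X ⇒ Y} → ρ⇒ ∘ (f ⊗₁ id) ≈ f ∘ ρ⇒
    pentagon  : ∀ {W X Y Z} →
                (id {W} ⊗₁ α⇒ {X} {Y} {Z}) ∘ α⇒ ∘ (α⇒ ⊗₁ id) ≈ α⇒ ∘ α⇒
    triangle  : ∀ {X Y} → (id {X} ⊗₁ λ⇒ {Y}) ∘ α⇒ ≈ ρ⇒ ⊗₁ id

record Symmetric {o ℓ e} {C : Category o ℓ e} (M : Monoidal C) : Set (o ⊔ ℓ ⊔ e) where
  open Category C
  open Monoidal M
  field
    σ : ∀ {X Y} → X ⊗₀ Y ⇒ Y ⊗₀ X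
    σ-natural : ∀ {X X′ Y Y′} {f : X ⇒ X′} {g : Y ⇒ Y′} →
                σ ∘ (f ⊗₁ g) ≈ (g ⊗₁ f) ∘ σ
    σ-involutive : ∀ {X Y} → σ {Y} {X} ∘ σ {X} {Y} ≈ id
    hexagon : ∀ {X Y Z} →
              (id {Y} ⊗₁ σ {X} {Z}) ∘ α⇒ ∘ (σ ⊗₁ id) ≈ α⇒ ∘ σ ∘ α⇒

record Closed {o ℓ e} {C : Category o ℓ e} (M : Monoidal C) : Set (o ⊔ ℓ ⊔ e) where
  open Category C
  open Monoidal M
  infixr 5 _⊸_
  field
    _⊸_   : Obj → Obj → Obj
    ev    : ∀ {X Y} → X ⊗₀ (X ⊸ Y) ⇒ Y
    curry : ∀ {X Y Z} → X ⊗₀ Z ⇒ Y → Z ⇒ X ⊸ Y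
    ev-curry     : ∀ {X Y Z} {f : X ⊗₀ Z ⇒ Y} → ev ∘ (id ⊗₁ curry f) ≈ f
    curry-unique : ∀ {X Y Z} {f : X ⊗₀ Z ⇒ Y} {g : Z ⇒ X ⊸ Y} →
                   ev ∘ (id ⊗₁ g) ≈ f → g ≈ curry f

record StarAutonomous (o ℓ e : Level) : Set (lsuc (o ⊔ ℓ ⊔ e)) where
  field
    category  : Category o ℓ e
    monoidal  : Monoidal category
    symmetric : Symmetric monoidal
    closed    : Closed monoidal
  open Category category public
  open Monoidal monoidal public
  open Symmetric symmetric public
  open Closed closed public
  field
    ⊥ : Obj
  dd : ∀ {X} → X ⇒ (X ⊸ ⊥) ⊸ ⊥
  dd {X} = curry (ev {X} {⊥} ∘ σ)
  field
    dd⁻¹    : ∀ {X} → (X ⊸ ⊥) ⊸ ⊥ ⇒ X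
    dd-isoˡ : ∀ {X} → dd⁻¹ ∘ dd {X} ≈ id
    dd-isoʳ : ∀ {X} → dd {X} ∘ dd⁻¹ ≈ id

  -- ψ : (X ⊗ Y) ⊸ Z → Y ⊸ (X ⊸ Z), the canonical arrow determined by
  -- ev ∘ (X ⊗ ev) ∘ α⇒ ∘ ((X ⊗ Y) ⊗ ψ) = ev
  ψ : ∀ {X Y Z} → (X ⊗₀ Y) ⊸ Z ⇒ Y ⊸ (X ⊸ Z)
  ψ {X} {Y} {Z} = curry (curry (ev {X ⊗₀ Y} {Z} ∘ α⇐))

record CompleteLattice (c ℓ₁ ℓ₂ ι : Level) : Set (lsuc (c ⊔ ℓ₁ ⊔ ℓ₂ ⊔ ι)) where
  infix 4 _≈_ _≤_
  field
    Carrier        : Set c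
    _≈_            : Rel Carrier ℓ₁
    _≤_            : Rel Carrier ℓ₂
    isPartialOrder : IsPartialOrder _≈_ _≤_
    ⋁              : {I : Set ι} → (I → Carrier) → Carrier
    ⋁-upper        : ∀ {I : Set ι} (f : I → Carrier) (i : I) → f i ≤ ⋁ f
    ⋁-least        : ∀ {I : Set ι} (f : I → Carrier) (x : Carrier) →
                     (∀ i → f i ≤ x) → ⋁ f ≤ x

open CompleteLattice using (Carrier)

-- Lax monoidal functors C → SLatt
-- (SLatt: complete lattices and sup-preserving maps; the monoidal
-- structure maps μ are bimorphisms, i.e. sup-preserving in each variable;
-- the unit of SLatt is the two-element lattice, so the unit map is an
-- element ε ∈ Q(I).)

record MonoidalFunctorToSLatt {o ℓ e} (C : StarAutonomous o ℓ e)
                              (c ℓ₁ ℓ₂ ι : Level)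
       : Set (o ⊔ ℓ ⊔ e ⊔ lsuc (c ⊔ ℓ₁ ⊔ ℓ₂ ⊔ ι)) where
  open StarAutonomous C using (Obj; _⇒_; _∘_; id; _⊗₀_; _⊗₁_; unit; α⇒; λ⇒; ρ⇒)
                        renaming (_≈_ to _≈C_)
  field
    F₀ : Obj → CompleteLattice c ℓ₁ ℓ₂ ι
  ⋁[_] : ∀ A {I : Set ι} → (I → Carrier (F₀ A)) → Carrier (F₀ A)
  ⋁[ A ] = CompleteLattice.⋁ (F₀ A)
  field
    F₁ : ∀ {A B} → A ⇒ B → Carrier (F₀ A) → Carrier (F₀ B)
    F₁-cong    : ∀ {A B} (f : A ⇒ B) {x y : Carrier (F₀ A)} →
                 CompleteLattice._≈_ (F₀ A) x y →
                 CompleteLattice._≈_ (F₀ B) (F₁ f x) (F₁ f y)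
    F₁-sup     : ∀ {A B} (f : A ⇒ B) {I : Set ι} (g : I → Carrier (F₀ A)) →
                 CompleteLattice._≈_ (F₀ B) (F₁ f (⋁[ A ] g)) (⋁[ B ] (λ i → F₁ f (g i)))
    F-resp-≈   : ∀ {A B} {f g : A ⇒ B} → f ≈C g → ∀ x →
                 CompleteLattice._≈_ (F₀ B) (F₁ f x) (F₁ g x)
    identity   : ∀ {A} x → CompleteLattice._≈_ (F₀ A) (F₁ (id {A}) x) x
    homomorphism : ∀ {A B D} {f : A ⇒ B} {g : B ⇒ D} x →
                 CompleteLattice._≈_ (F₀ D) (F₁ (g ∘ f) x) (F₁ g (F₁ f x))
    μ          : ∀ {A B} → Carrier (F₀ A) → Carrier (F₀ B) → Carrier (F₀ (A ⊗₀ B))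
    μ-cong     : ∀ {A B} {x x′ : Carrier (F₀ A)} {y y′ : Carrier (F₀ B)} →
                 CompleteLattice._≈_ (F₀ A) x x′ → CompleteLattice._≈_ (F₀ B) y y′ →
                 CompleteLattice._≈_ (F₀ (A ⊗₀ B)) (μ x y) (μ x′ y′)
    μ-supˡ     : ∀ {A B} {I : Set ι} (g : I → Carrier (F₀ A)) (y : Carrier (F₀ B)) →
                 CompleteLattice._≈_ (F₀ (A ⊗₀ B)) (μ (⋁[ A ] g) y) (⋁[ A ⊗₀ B ] (λ i → μ (g i) y))
    μ-supʳ     : ∀ {A B} {I : Set ι} (x : Carrier (F₀ A)) (g : I → Carrier (F₀ B)) →
                 CompleteLattice._≈_ (F₀ (A ⊗₀ B)) (μ x (⋁[ B ] g)) (⋁[ A ⊗₀ B ] (λ i → μ x (g i)))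
    μ-natural  : ∀ {A A′ B B′} (f : A ⇒ A′) (g : B ⇒ B′) x y →
                 CompleteLattice._≈_ (F₀ (A′ ⊗₀ B′)) (F₁ (f ⊗₁ g) (μ x y)) (μ (F₁ f x) (F₁ g y))
    ε          : Carrier (F₀ unit)
    μ-assoc    : ∀ {A B D} x y z →
                 CompleteLattice._≈_ (F₀ (A ⊗₀ (B ⊗₀ D))) (F₁ α⇒ (μ (μ x y) z)) (μ x (μ y z))
    μ-unitˡ    : ∀ {A} x → CompleteLattice._≈_ (F₀ A) (F₁ λ⇒ (μ ε x)) x
    μ-unitʳ    : ∀ {A} x → CompleteLattice._≈_ (F₀ A) (F₁ ρ⇒ (μ x ε)) x

  open StarAutonomous C using (_⊸_; ev)

  pairing : ∀ {X Y} → Carrier (F₀ X) → Carrier (F₀ (X ⊸ Y)) → Carrier (F₀ Y)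
  pairing {X} {Y} a f = F₁ (ev {X} {Y}) (μ a f)

{-# OPTIONS --safe #-}
module Submission where

-- Both sides are images of μ (μ a b) γ : the right-hand side, after μ-assoc and
-- naturality of μ, is Q(ev ∘ (X ⊗ ev) ∘ α ∘ (X ⊗ Y ⊗ ψ)) applied to it, and that
-- composite is ev_{X⊗Y,Z} by the defining property of ψ.

open import Defs
open import Level using (Level)
open import Relation.Binary using (Setoid; IsEquivalence; IsPartialOrder)
import Relation.Binary.Reasoning.Setoid as SetoidReasoning

module StarAutonomousProperties {o ℓ e} (C : StarAutonomous o ℓ e) where
  open StarAutonomous C

  hom-setoid : Obj → Obj → Setoid ℓ e
  hom-setoid A B = record { Carrier = A ⇒ B ; _≈_ = _≈_ ; isEquivalence = equiv }

  module ≈ {A B} = IsEquivalence (equiv {A} {B})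

  α⇒-id⊗ : ∀ {X Y W W′} {f : W ⇒ W′} →
           α⇒ {X} {Y} ∘ (id ⊗₁ f) ≈ (id ⊗₁ (id ⊗₁ f)) ∘ α⇒
  α⇒-id⊗ = ≈.trans (∘-resp-≈ ≈.refl (⊗-resp-≈ (≈.sym ⊗-identity) ≈.refl)) α-natural

  ev-ψ : ∀ {X Y Z} →
         ev {X} {Z} ∘ ((id ⊗₁ ev) ∘ (α⇒ ∘ (id ⊗₁ ψ {X} {Y} {Z}))) ≈ ev
  ev-ψ {X} {Y} {Z} = begin
      ev ∘ ((id ⊗₁ ev) ∘ (α⇒ ∘ (id ⊗₁ ψ)))
    ≈⟨ ∘-resp-≈ ≈.refl (∘-resp-≈ ≈.refl α⇒-id⊗) ⟩
      ev ∘ ((id ⊗₁ ev) ∘ ((id ⊗₁ (id ⊗₁ ψ)) ∘ α⇒))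
    ≈⟨ ∘-resp-≈ ≈.refl (≈.sym assoc) ⟩
      ev ∘ (((id ⊗₁ ev) ∘ (id ⊗₁ (id ⊗₁ ψ))) ∘ α⇒)
    ≈⟨ ∘-resp-≈ ≈.refl (∘-resp-≈ (≈.trans (≈.sym ⊗-homomorphism) (⊗-resp-≈ identityˡ ev-curry)) ≈.refl) ⟩
      ev ∘ ((id ⊗₁ curry (ev ∘ α⇐)) ∘ α⇒)
    ≈⟨ ≈.sym assoc ⟩
      (ev ∘ (id ⊗₁ curry (ev ∘ α⇐))) ∘ α⇒
    ≈⟨ ∘-resp-≈ ev-curry ≈.refl ⟩
      (ev ∘ α⇐) ∘ α⇒
    ≈⟨ assoc ⟩
      ev ∘ (α⇐ ∘ α⇒)
    ≈⟨ ∘-resp-≈ ≈.refl α-isoˡ ⟩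
      ev ∘ id
    ≈⟨ identityʳ ⟩
      ev ∎
    where open SetoidReasoning (hom-setoid _ _)

module MonoidalFunctorProperties {o ℓ e c ℓ₁ ℓ₂ ι : Level}
    {C : StarAutonomous o ℓ e} (Q : MonoidalFunctorToSLatt C c ℓ₁ ℓ₂ ι) where
  open StarAutonomous C
  open MonoidalFunctorToSLatt Q
  module L A = CompleteLattice (F₀ A)

  isEquivalence : ∀ A → IsEquivalence (L._≈_ A)
  isEquivalence A = IsPartialOrder.isEquivalence (L.isPartialOrder A)

  setoid : Obj → Setoid c ℓ₁
  setoid A = record { isEquivalence = isEquivalence A }

  module ≃ {A} = IsEquivalence (isEquivalence A)

  μ-naturalʳ : ∀ {A B B′} (f : B ⇒ B′) (x : L.Carrier A) y →
               L._≈_ (A ⊗₀ B′) (μ x (F₁ f y)) (F₁ (id ⊗₁ f) (μ x y))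
  μ-naturalʳ f x y = ≃.sym (≃.trans (μ-natural id f x y) (μ-cong (identity x) ≃.refl))

  homomorphism₄ : ∀ {A B D E G} {f : A ⇒ B} {g : B ⇒ D} {h : D ⇒ E} {k : E ⇒ G} x →
                  L._≈_ G (F₁ (k ∘ (h ∘ (g ∘ f))) x) (F₁ k (F₁ h (F₁ g (F₁ f x))))
  homomorphism₄ {k = k} x =
    ≃.trans (homomorphism x) (F₁-cong k (≃.trans (homomorphism _) (F₁-cong _ (homomorphism _))))

  pairing-μ : ∀ {X Y Z} a b (g : L.Carrier ((X ⊗₀ Y) ⊸ Z)) →
              L._≈_ Z (pairing a (pairing b (F₁ ψ g)))
                      (F₁ (ev ∘ ((id ⊗₁ ev) ∘ (α⇒ ∘ (id ⊗₁ ψ)))) (μ (μ a b) g))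
  pairing-μ a b g = begin
      F₁ ev (μ a (F₁ ev (μ b (F₁ ψ g))))
    ≈⟨ F₁-cong ev (μ-naturalʳ ev a _) ⟩
      F₁ ev (F₁ (id ⊗₁ ev) (μ a (μ b (F₁ ψ g))))
    ≈⟨ F₁-cong ev (F₁-cong (id ⊗₁ ev) (≃.sym (μ-assoc a b _))) ⟩
      F₁ ev (F₁ (id ⊗₁ ev) (F₁ α⇒ (μ (μ a b) (F₁ ψ g))))
    ≈⟨ F₁-cong ev (F₁-cong (id ⊗₁ ev) (F₁-cong α⇒ (μ-naturalʳ ψ (μ a b) g))) ⟩
      F₁ ev (F₁ (id ⊗₁ ev) (F₁ α⇒ (F₁ (id ⊗₁ ψ) (μ (μ a b) g))))
    ≈⟨ ≃.sym (homomorphism₄ _) ⟩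
      F₁ (ev ∘ ((id ⊗₁ ev) ∘ (α⇒ ∘ (id ⊗₁ ψ)))) (μ (μ a b) g) ∎
    where open SetoidReasoning (setoid _)

mainTheorem17 : ∀ {o ℓ e c ℓ₁ ℓ₂ ι : Level}
    (C : StarAutonomous o ℓ e) (Q : MonoidalFunctorToSLatt C c ℓ₁ ℓ₂ ι)
    (X Y Z : StarAutonomous.Obj C)
    (a : CompleteLattice.Carrier (MonoidalFunctorToSLatt.F₀ Q X))
    (b : CompleteLattice.Carrier (MonoidalFunctorToSLatt.F₀ Q Y))
    (g : CompleteLattice.Carrier
    (MonoidalFunctorToSLatt.F₀ Q (StarAutonomous._⊸_ C (StarAutonomous._⊗₀_ C X Y) Z))) →
    CompleteLattice._≈_ (MonoidalFunctorToSLatt.F₀ Q Z)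
    (MonoidalFunctorToSLatt.pairing Q {StarAutonomous._⊗₀_ C X Y} {Z}
    (MonoidalFunctorToSLatt.μ Q a b) g)
    (MonoidalFunctorToSLatt.pairing Q {X} {Z} a
    (MonoidalFunctorToSLatt.pairing Q {Y} {StarAutonomous._⊸_ C X Z} b
    (MonoidalFunctorToSLatt.F₁ Q (StarAutonomous.ψ C {X} {Y} {Z}) g)))
mainTheorem17 C Q X Y Z a b g =
  ≃.sym (≃.trans (pairing-μ a b g) (F-resp-≈ (ev-ψ {X} {Y} {Z}) (μ (μ a b) g)))
  where
  open StarAutonomousProperties C using (ev-ψ)
  open MonoidalFunctorProperties Q using (pairing-μ; module ≃)
  open MonoidalFunctorToSLatt Q using (F-resp-≈; μ)
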